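{- Let $G_1,G_2$ be finite simple graphs, where $G_l$ has order $n_l$, maximum degree $\Delta_l$ and minimum degree $\delta_l$, $l\in\{1,2\}$, and let $k_l\in\{1-\delta_l,\dots,\Delta_l-2\}$ be integers. Then: (i) For $i,j\in\{1,2\}$ with $i\neq j$ and every integer $k\in\{\Delta_j-\Delta_i,\dots,\Delta_i+\Delta_j-2\}$, $$\phi_k^p(G_1\times G_2)\ge n_j\,\phi^p_{k-\Delta_j}(G_i).$$ (ii) For every integer $k\in\{k_1+k_2-1,\dots,\Delta_1+\Delta_2-2\}$, $$\phi_k^p(G_1\times G_2)\ge \phi^p_{k_1}(G_1)\,\phi^p_{k_2}(G_2)+\min\{n_1-\phi^p_{k_1}(G_1),\,n_2-\phi^p_{k_2}(G_2)\}.$$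
   Context: For a graph $G=(V,E)$, a set $S\subseteq V$ and $v\in V$, $\delta_S(v)=|\{u\in S: uv\in E\}|$, $\overline{S}=V\setminus S$, and $\partial S$ is the set of vertices of $\overline{S}$ adjacent to at least one vertex of $S$. For an integer $k$, a non-empty set $S\subseteq V$ is a defensive $k$-alliance if $\delta_S(v)\ge \delta_{\overline{S}}(v)+k$ for every $v\in S$, and an offensive $k$-alliance if $\delta_S(v)\ge \delta_{\overline{S}}(v)+k$ for every $v\in\partial S$. A non-empty set is a powerful $k$-alliance if it is both a defensive $k$-alliance and an offensive $(k+2)$-alliance. A set $X\subseteq V$ is powerful $k$-alliance free ($k$-paf) if $X$ contains no powerful $k$-alliance as a subset; $\phi_k^p(G)$ is the maximum cardinality of a $k$-paf set in $G$. The Cartesian product $G_1\times G_2$ has vertex set $V_1\times V_2$, with $(a,b)$ adjacent to $(c,d)$ iff either $a=c$ and $bd\in E_2$, or $b=d$ and $ac\in E_1$. -}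

module Defs where

open import Data.Bool using (Bool; true; false; _∧_; _∨_)
open import Data.Nat as ℕ using (ℕ; _⊔_; _⊓_)
open import Data.Integer as ℤ using (ℤ; +_)
open import Data.Fin using (Fin; remQuot; _≟_)
open import Data.Fin.Subset using (Subset; _∈_; _∉_; _⊆_; ∁; _∩_; ∣_∣; Nonempty)
open import Data.List using (foldr; allFin)
open import Data.Vec using (tabulate)
open import Data.Product using (_×_; ∃; _,_; proj₁; proj₂)
open import Relation.Binary.PropositionalEquality as ≡ using (_≡_; refl)
open import Data.Empty using (⊥-elim)
open import Relation.Nullary using (¬_; yes; no)
open import Relation.Nullary.Decidable using (⌊_⌋)

record Graph : Set where
  field
    n      : ℕ
    adj    : Fin n → Fin n → Bool
    sym    : ∀ u v → adj u v ≡ adj v u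
    irrefl : ∀ v → adj v v ≡ false

open Graph public

order : Graph → ℕ
order G = n G

N : (G : Graph) → Fin (n G) → Subset (n G)
N G v = tabulate (adj G v)

δ[_,_]_ : (G : Graph) → Subset (n G) → Fin (n G) → ℕ
δ[ G , S ] v = ∣ S ∩ N G v ∣

deg : (G : Graph) → Fin (n G) → ℕ
deg G v = ∣ N G v ∣

maxDeg : Graph → ℕ
maxDeg G = foldr (λ v acc → deg G v ⊔ acc) 0 (allFin (n G))

-- minimum degree δ(G) (every degree is < n, so n is a neutral start value;
-- for the empty graph this gives 0)
minDeg : Graph → ℕ
minDeg G = foldr (λ v acc → deg G v ⊓ acc) (n G) (allFin (n G))

Strong : (G : Graph) → Subset (n G) → ℤ → Fin (n G) → Set
Strong G S k v = (+ (δ[ G , ∁ S ] v)) ℤ.+ k ℤ.≤ + (δ[ G , S ] v)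

DefensiveAlliance : (G : Graph) → ℤ → Subset (n G) → Set
DefensiveAlliance G k S =
  Nonempty S × (∀ v → v ∈ S → Strong G S k v)

OffensiveAlliance : (G : Graph) → ℤ → Subset (n G) → Set
OffensiveAlliance G k S =
  Nonempty S × (∀ v → v ∉ S → (∃ λ u → u ∈ S × adj G u v ≡ true) → Strong G S k v)

PowerfulAlliance : (G : Graph) → ℤ → Subset (n G) → Set
PowerfulAlliance G k S =
  DefensiveAlliance G k S × OffensiveAlliance G (k ℤ.+ + 2) S

PAF : (G : Graph) → ℤ → Subset (n G) → Set
PAF G k X = ∀ S → S ⊆ X → ¬ PowerfulAlliance G k S

-- "m = φ^p_k(G)": m is the maximum cardinality of a k-paf set of G
IsPhi : (G : Graph) → ℤ → ℕ → Set
IsPhi G k m = (∃ λ X → PAF G k X × ∣ X ∣ ≡ m) × (∀ X → PAF G k X → ∣ X ∣ ℕ.≤ m)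

≟-comm : ∀ {m} (a c : Fin m) → ⌊ a ≟ c ⌋ ≡ ⌊ c ≟ a ⌋
≟-comm a c with a ≟ c | c ≟ a
... | yes _ | yes _ = refl
... | no _ | no _ = refl
... | yes p | no q = ⊥-elim (q (≡.sym p))
... | no p | yes q = ⊥-elim (p (≡.sym q))

≟-refl : ∀ {m} (a : Fin m) → ⌊ a ≟ a ⌋ ≡ true
≟-refl a with a ≟ a
... | yes _ = refl
... | no p = ⊥-elim (p refl)

-- Cartesian product G₁ × G₂ on Fin (n₁ * n₂), vertex x ↔ remQuot n₂ x = (a , b)
_□_ : Graph → Graph → Graph
G₁ □ G₂ = record
  { n = n G₁ ℕ.* n G₂
  ; adj = λ x y → padj (remQuot (n G₂) x) (remQuot (n G₂) y)
  ; sym = λ x y → psym (remQuot (n G₂) x) (remQuot (n G₂) y)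
  ; irrefl = λ x → pirr (remQuot (n G₂) x)
  }
  where
  padj : Fin (n G₁) × Fin (n G₂) → Fin (n G₁) × Fin (n G₂) → Bool
  padj (a , b) (c , d) = (⌊ a ≟ c ⌋ ∧ adj G₂ b d) ∨ (⌊ b ≟ d ⌋ ∧ adj G₁ a c)
  psym : ∀ p q → padj p q ≡ padj q p
  psym (a , b) (c , d)
    rewrite ≟-comm a c | ≟-comm b d | Graph.sym G₂ b d | Graph.sym G₁ a c = refl
  pirr : ∀ p → padj p p ≡ false
  pirr (a , b) rewrite ≟-refl a | ≟-refl b | irrefl G₂ b | irrefl G₁ a = refl

-- Each bound exhibits a k-paf set Y of P of the required size and uses maximality of φ^p_k(P).
-- The key tool is the decomposition δ_S(a,b) = δ_{row S b}(a) + δ_{col S a}(b) of the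
-- neighbours of (a,b) into those in its row {(c,b)} and in its column {(a,d)}.
--  (i)  For X (k-Δ₂)-paf in G₁, Y = X × V(G₂): column neighbours contribute at most Δ₂, so a
--       non-empty row of a powerful k-alliance S ⊆ Y is a powerful (k-Δ₂)-alliance inside X.
--  (ii) For X₁ k₁-paf and X₂ k₂-paf, Y = (X₁ × X₂) ∪ D with D an order-preserving matching of
--       V₁∖X₁ with V₂∖X₂.  A matched vertex of a powerful k-alliance S ⊆ Y has no neighbour in S,
--       which k ≥ k₁ + k₂ - 1 forbids; so S ⊆ X₁ × X₂.  The projection A of S to G₁ is an offensive
--       (k₁+2)-alliance; either it is a powerful k₁-alliance inside X₁, or at a vertex where A is
--       not defensive the column of S is a powerful k₂-alliance inside X₂.  The upper bounds on k, k₁, k₂ are unused.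

module Submission where

open import Defs
open import Data.Nat as ℕ using (ℕ; _⊓_; _∸_)
open import Data.Integer as ℤ using (ℤ; +_)
open import Data.Product using (_×_)

import Data.Nat.Properties as ℕP
open import Algebra.Properties.Semiring.Sum ℕP.+-*-semiring
  using (sum; sum-cong-≗; sum-replicate-zero; ∑-distrib-+; ∑-comm; *-distribˡ-sum; *-distribʳ-sum)
open import Data.Bool using (Bool; true; false; _∧_; _∨_; not)
open import Data.Bool.Properties using (∨-zeroʳ; ∧-zeroʳ; T-≡)
open import Data.Empty using (⊥; ⊥-elim)
open import Data.Fin using (Fin; zero; suc; _↑ˡ_; _↑ʳ_; combine; remQuot; _≟_)
open import Data.Fin.Properties using (suc-injective; all?; any?; ¬∀⟶∃¬; remQuot-combine; combine-remQuot)
open import Data.Fin.Subset using (Subset; _∈_; _∉_; _⊆_; ∁; _∩_; ∣_∣; Nonempty)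
open import Data.Fin.Subset.Properties
  using (_∈?_; p⊆q⇒∣p∣≤∣q∣; ∣p∩q∣≤∣q∣; x∈p∩q⁺; x∈p∩q⁻; ∣∁p∣≡n∸∣p∣; x∉p⇒x∈∁p; x∈∁p⇒x∉p)
open import Data.Integer using (0ℤ)
import Data.Integer.Properties as ℤP
open import Data.Integer.Solver using (module +-*-Solver)
open import Data.List using (foldr; allFin; _∷_)
open import Data.List.Membership.Propositional using () renaming (_∈_ to _∈ₗ_)
open import Data.List.Membership.Propositional.Properties using (∈-allFin)
open import Data.List.Relation.Unary.Any using (here; there)
open import Data.Nat using (_⊔_)
open import Data.Product using (∃; ∃₂; _,_; proj₁; proj₂)
open import Data.Sum using (_⊎_; inj₁; inj₂)
open import Data.Vec using ([]; _∷_; lookup; tabulate)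
open import Data.Vec.Properties
  using (lookup-map; lookup∘tabulate; lookup-zipWith; tabulate-cong; tabulate-∘; []=⇒lookup; lookup⇒[]=)
open import Function.Base using (case_of_)
open import Function.Bundles using (mk⇔; Equivalence)
open import Relation.Binary.PropositionalEquality as ≡ hiding (sym)
open import Relation.Nullary.Decidable
  using (Dec; yes; no; ⌊_⌋; _→-dec_; does-⇔; isYes≗does; decidable-stable; toWitness; fromWitness)
open import Relation.Nullary.Negation using (¬_; contradiction)

-- Finite sums, counting and Booleans

χ : Bool → ℕ
χ true  = 1
χ false = 0

count : ∀ n → (Fin n → Bool) → ℕ
count n f = sum {n} (λ i → χ (f i))

sum-const : ∀ n c → sum {n} (λ _ → c) ≡ n ℕ.* c
sum-const ℕ.zero    c = refl
sum-const (ℕ.suc n) c = cong (c ℕ.+_) (sum-const n c)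

count-false : ∀ n (f : Fin n → Bool) → (∀ i → f i ≡ false) → count n f ≡ 0
count-false n f f≡false = trans (sum-cong-≗ (λ i → cong χ (f≡false i))) (sum-replicate-zero n)

-- ⌊_⌋ computes by matching on the decision, so its behaviour on suc is only propositional.
≟-suc : ∀ {n} (a b : Fin n) → ⌊ suc a ≟ suc b ⌋ ≡ ⌊ a ≟ b ⌋
≟-suc a b = trans (isYes≗does (suc a ≟ suc b))
  (trans (does-⇔ (mk⇔ suc-injective (cong suc)) (suc a ≟ suc b) (a ≟ b)) (≡.sym (isYes≗does (a ≟ b))))

≟⇒≡ : ∀ {n} (a c : Fin n) → ⌊ a ≟ c ⌋ ≡ true → a ≡ c
≟⇒≡ a c eq with a ≟ c
≟⇒≡ a c eq | yes a≡c = a≡c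
≟⇒≡ a c () | no _

sum-indicator : ∀ {n} (a : Fin n) (h : Fin n → Bool) → sum (λ i → χ (⌊ a ≟ i ⌋ ∧ h i)) ≡ χ (h a)
sum-indicator {ℕ.suc n} zero    h = trans (cong (χ (h zero) ℕ.+_) (sum-replicate-zero n)) (ℕP.+-identityʳ (χ (h zero)))
sum-indicator {ℕ.suc n} (suc a) h =
  trans (sum-cong-≗ (λ i → cong (λ t → χ (t ∧ h (suc i))) (≟-suc a i))) (sum-indicator a (λ i → h (suc i)))

sum-split : ∀ m n (f : Fin (m ℕ.+ n) → ℕ) →
  sum f ≡ sum (λ i → f (i ↑ˡ n)) ℕ.+ sum (λ j → f (m ↑ʳ j))
sum-split ℕ.zero    n f = refl
sum-split (ℕ.suc m) n f =
  trans (cong (f zero ℕ.+_) (sum-split m n (λ i → f (suc i)))) (≡.sym (ℕP.+-assoc (f zero) _ _))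

sum-combine : ∀ m n (f : Fin (m ℕ.* n) → ℕ) →
  sum f ≡ sum (λ a → sum (λ b → f (combine {m} a b)))
sum-combine ℕ.zero    n f = refl
sum-combine (ℕ.suc m) n f =
  trans (sum-split n (m ℕ.* n) f) (cong (sum (λ j → f (j ↑ˡ (m ℕ.* n))) ℕ.+_) (sum-combine m n (λ x → f (n ↑ʳ x))))

sum-product : ∀ m n (f : Fin m → Bool) (g : Fin n → Bool) →
  sum (λ a → count n (λ b → f a ∧ g b)) ≡ count m f ℕ.* count n g
sum-product m n f g = begin
  sum (λ a → count n (λ b → f a ∧ g b))       ≡⟨ sum-cong-≗ (λ a → sum-cong-≗ (λ b → χ-∧ (f a) (g b))) ⟩
  sum (λ a → sum (λ b → χ (f a) ℕ.* χ (g b))) ≡⟨ sum-cong-≗ (λ a → ≡.sym (*-distribˡ-sum (χ (f a)) (λ b → χ (g b)))) ⟩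
  sum (λ a → χ (f a) ℕ.* count n g)           ≡⟨ ≡.sym (*-distribʳ-sum (count n g) (λ a → χ (f a))) ⟩
  count m f ℕ.* count n g ∎
  where
  open ≡-Reasoning
  χ-∧ : ∀ x y → χ (x ∧ y) ≡ χ x ℕ.* χ y
  χ-∧ true  y = ≡.sym (ℕP.+-identityʳ (χ y))
  χ-∧ false y = refl

∣∣≡count : ∀ {n} (p : Subset n) → ∣ p ∣ ≡ count n (lookup p)
∣∣≡count []          = refl
∣∣≡count (true  ∷ p) = cong ℕ.suc (∣∣≡count p)
∣∣≡count (false ∷ p) = ∣∣≡count p

count-∁ : ∀ {n} (X : Subset n) → count n (λ i → not (lookup X i)) ≡ n ∸ ∣ X ∣
count-∁ {n} X = trans (sum-cong-≗ (λ i → cong χ (≡.sym (lookup-map i not X))))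
  (trans (≡.sym (∣∣≡count (∁ X))) (∣∁p∣≡n∸∣p∣ X))

∈⇒true : ∀ {n} {x : Fin n} {p : Subset n} → x ∈ p → lookup p x ≡ true
∈⇒true = []=⇒lookup

true⇒∈ : ∀ {n} {x : Fin n} {p : Subset n} → lookup p x ≡ true → x ∈ p
true⇒∈ {x = x} {p} = lookup⇒[]= x p

∧-true : ∀ {x y} → x ∧ y ≡ true → x ≡ true × y ≡ true
∧-true {true} {true} _ = refl , refl

∨-true : ∀ {x y} → x ∨ y ≡ true → x ≡ true ⊎ y ≡ true
∨-true {true}  _ = inj₁ refl
∨-true {false} e = inj₂ e

not-true : ∀ {x} → x ≡ true → not x ≡ true → ⊥
not-true {true} _ ()

all-or-counterexample : ∀ {n} (p : Subset n) (Q : Fin n → Set) → (∀ a → Dec (Q a)) →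
  (∀ a → a ∈ p → Q a) ⊎ ∃ λ a → a ∈ p × ¬ Q a
all-or-counterexample p Q Q? with all? (λ a → (a ∈? p) →-dec Q? a)
... | yes all = inj₁ all
... | no ¬all with ¬∀⟶∃¬ _ _ (λ a → (a ∈? p) →-dec Q? a) ¬all
...   | a , ¬imp = inj₂ (a , decidable-stable (a ∈? p) (λ a∉ → ¬imp (λ a∈ → ⊥-elim (a∉ a∈))) , λ q → ¬imp (λ _ → q))

-- Degrees in a graph

δ-count : ∀ G S v → δ[ G , S ] v ≡ count (n G) (λ u → lookup S u ∧ adj G v u)
δ-count G S v = trans (∣∣≡count (S ∩ N G v)) (sum-cong-≗ λ u → cong χ
  (trans (lookup-zipWith _∧_ u S (tabulate (adj G v))) (cong (lookup S u ∧_) (lookup∘tabulate (adj G v) u))))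

deg-count : ∀ G v → deg G v ≡ count (n G) (adj G v)
deg-count G v = trans (∣∣≡count (N G v)) (sum-cong-≗ λ u → cong χ (lookup∘tabulate (adj G v) u))

δ+δ∁≡deg : ∀ G S v → δ[ G , S ] v ℕ.+ δ[ G , ∁ S ] v ≡ deg G v
δ+δ∁≡deg G S v = begin
  δ[ G , S ] v ℕ.+ δ[ G , ∁ S ] v
    ≡⟨ cong₂ ℕ._+_ (δ-count G S v) (δ-count G (∁ S) v) ⟩
  count (n G) (λ u → lookup S u ∧ adj G v u) ℕ.+ count (n G) (λ u → lookup (∁ S) u ∧ adj G v u)
    ≡⟨ ≡.sym (∑-distrib-+ (λ u → χ (lookup S u ∧ adj G v u)) (λ u → χ (lookup (∁ S) u ∧ adj G v u))) ⟩
  sum (λ u → χ (lookup S u ∧ adj G v u) ℕ.+ χ (lookup (∁ S) u ∧ adj G v u))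
    ≡⟨ sum-cong-≗ (λ u → trans (cong (λ t → χ (lookup S u ∧ adj G v u) ℕ.+ χ (t ∧ adj G v u)) (lookup-map u not S))
                                (χ-split (lookup S u) (adj G v u))) ⟩
  count (n G) (adj G v)
    ≡⟨ ≡.sym (deg-count G v) ⟩
  deg G v ∎
  where
  open ≡-Reasoning
  χ-split : ∀ s t → χ (s ∧ t) ℕ.+ χ (not s ∧ t) ≡ χ t
  χ-split true  t = ℕP.+-identityʳ (χ t)
  χ-split false t = refl

δ-mono : ∀ G {S T} v → S ⊆ T → δ[ G , S ] v ℕ.≤ δ[ G , T ] v
δ-mono G {S} v S⊆T = p⊆q⇒∣p∣≤∣q∣ λ u∈ →
  let (u∈S , u∈N) = x∈p∩q⁻ S (N G v) u∈ in x∈p∩q⁺ (S⊆T u∈S , u∈N)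

δ≤deg : ∀ G S v → δ[ G , S ] v ℕ.≤ deg G v
δ≤deg G S v = ∣p∩q∣≤∣q∣ S (N G v)

deg≤maxDeg : ∀ G v → deg G v ℕ.≤ maxDeg G
deg≤maxDeg G v = go (allFin (n G)) (∈-allFin v)
  where
  go : ∀ xs → v ∈ₗ xs → deg G v ℕ.≤ foldr (λ u acc → deg G u ⊔ acc) 0 xs
  go (x ∷ xs) (here refl) = ℕP.m≤m⊔n (deg G x) _
  go (x ∷ xs) (there v∈)  = ℕP.≤-trans (go xs v∈) (ℕP.m≤n⊔m (deg G x) _)

minDeg≤deg : ∀ G v → minDeg G ℕ.≤ deg G v
minDeg≤deg G v = go (allFin (n G)) (∈-allFin v)
  where
  go : ∀ xs → v ∈ₗ xs → foldr (λ u acc → deg G u ⊓ acc) (n G) xs ℕ.≤ deg G v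
  go (x ∷ xs) (here refl) = ℕP.m⊓n≤m (deg G x) _
  go (x ∷ xs) (there v∈)  = ℕP.≤-trans (ℕP.m⊓n≤n (deg G x) _) (go xs v∈)

no-loop : ∀ G {u v} → u ≡ v → adj G v u ≡ true → ⊥
no-loop G {v = v} refl v~v = case trans (≡.sym v~v) (irrefl G v) of λ ()

no-neighbours : ∀ G S v → (∀ u → u ∈ S → adj G v u ≡ true → ⊥) → δ[ G , S ] v ≡ 0
no-neighbours G S v none = trans (δ-count G S v) (count-false (n G) _ outside)
  where
  outside : ∀ u → lookup S u ∧ adj G v u ≡ false
  outside u with lookup S u in u∈S | adj G v u in v~u
  ... | false | _     = refl
  ... | true  | false = refl
  ... | true  | true  = ⊥-elim (none u (true⇒∈ u∈S) v~u)

minDeg≤δ∁ : ∀ G S v → δ[ G , S ] v ≡ 0 → minDeg G ℕ.≤ δ[ G , ∁ S ] v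
minDeg≤δ∁ G S v δ≡0 =
  subst (minDeg G ℕ.≤_) (trans (≡.sym (δ+δ∁≡deg G S v)) (cong (ℕ._+ δ[ G , ∁ S ] v) δ≡0)) (minDeg≤deg G v)

-- Linear inequalities over ℤ
--
-- Each inequality a ≤ b below is proved by writing b - a as a sum of non-negative slacks
-- coming from the hypotheses; the ring solver checks the underlying identity.

by-slack : ∀ {a b : ℤ} (s : ℤ) → 0ℤ ℤ.≤ s → s ≡ b ℤ.- a → a ℤ.≤ b
by-slack s 0≤s s≡b-a = ℤP.0≤i-j⇒j≤i (subst (0ℤ ℤ.≤_) s≡b-a 0≤s)

gap : ∀ {a b : ℤ} → a ℤ.≤ b → 0ℤ ℤ.≤ b ℤ.- a
gap = ℤP.i≤j⇒0≤j-i

gapℕ : ∀ {a b : ℕ} → a ℕ.≤ b → 0ℤ ℤ.≤ + b ℤ.- + a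
gapℕ a≤b = gap (ℤ.+≤+ a≤b)

infixr 5 _⊕_
_⊕_ : ∀ {a b : ℤ} → 0ℤ ℤ.≤ a → 0ℤ ℤ.≤ b → 0ℤ ℤ.≤ a ℤ.+ b
_⊕_ = ℤP.+-mono-≤

module _ where
  open +-*-Solver

  -- From o₁ + o₂ + K ≤ i₁ + i₂ with i₂ ≤ Δ, the first summands satisfy o₁ + T ≤ i₁ whenever
  -- T + Δ ≤ K.  This passes the strength of a vertex of G₁ □ G₂ to its row (or column).
  drop-bounded-part : ∀ (o₁ o₂ i₁ i₂ Δ : ℕ) (K T : ℤ) →
    + (o₁ ℕ.+ o₂) ℤ.+ K ℤ.≤ + (i₁ ℕ.+ i₂) → i₂ ℕ.≤ Δ → T ℤ.+ + Δ ℤ.≤ K →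
    + o₁ ℤ.+ T ℤ.≤ + i₁
  drop-bounded-part o₁ o₂ i₁ i₂ Δ K T strong i₂≤Δ T+Δ≤K =
    by-slack _ (gap strong ⊕ gapℕ i₂≤Δ ⊕ ℤ.+≤+ (ℕ.z≤n {o₂}) ⊕ gap T+Δ≤K)
      (solve 7 (λ o₁ o₂ i₁ i₂ Δ K T →
          ((i₁ :+ i₂) :- ((o₁ :+ o₂) :+ K)) :+ ((Δ :- i₂) :+ (o₂ :+ (K :- (T :+ Δ))))
          := i₁ :- (o₁ :+ T))
        refl (+ o₁) (+ o₂) (+ i₁) (+ i₂) (+ Δ) K T)

  -- Offensive inequality of the projection A of S at a ∉ A: the vertex (a,b) of G₁ □ G₂
  -- satisfies the (k+2)-inequality, has row-neighbours rIn ≤ inA in S and rOut ≥ outA outside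
  -- S, and its column holds no vertex of S, so at least δ₂ column-neighbours lie outside S.
  projection-inequality : ∀ (outA rOut rIn inA cOut δ₂ : ℕ) (k k₁ k₂ : ℤ) →
    outA ℕ.≤ rOut → rIn ℕ.≤ inA → + (rOut ℕ.+ cOut) ℤ.+ (k ℤ.+ + 2) ℤ.≤ + rIn →
    k₁ ℤ.+ k₂ ℤ.- + 1 ℤ.≤ k → + 1 ℤ.- + δ₂ ℤ.≤ k₂ → δ₂ ℕ.≤ cOut →
    + outA ℤ.+ (k₁ ℤ.+ + 2) ℤ.≤ + inA
  projection-inequality outA rOut rIn inA cOut δ₂ k k₁ k₂ outA≤ ≤inA strong k≥ k₂≥ δ₂≤ =
    by-slack _ (gapℕ ≤inA ⊕ gapℕ outA≤ ⊕ gap strong ⊕ gap k≥ ⊕ gap k₂≥ ⊕ gapℕ δ₂≤)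
      (solve 9 (λ outA rOut rIn inA cOut δ₂ k k₁ k₂ →
          (inA :- rIn) :+ ((rOut :- outA) :+ ((rIn :- ((rOut :+ cOut) :+ (k :+ con (+ 2))))
            :+ ((k :- (k₁ :+ k₂ :- con (+ 1))) :+ ((k₂ :- (con (+ 1) :- δ₂)) :+ (cOut :- δ₂)))))
          := inA :- (outA :+ (k₁ :+ con (+ 2))))
        refl (+ outA) (+ rOut) (+ rIn) (+ inA) (+ cOut) (+ δ₂) k k₁ k₂)

  -- If A violates the defensive k₁-inequality at a (1 + inA ≤ outA + k₁), then at every
  -- vertex (a,d) satisfying the K-inequality of S the column through a satisfies the
  -- k₂-inequality, provided k₁ + k₂ - 1 ≤ K.
  column-inequality : ∀ (rIn inA outA rOut cOut cIn : ℕ) (K k₁ k₂ : ℤ) →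
    rIn ℕ.≤ inA → outA ℕ.≤ rOut → + 1 ℤ.+ + inA ℤ.≤ + outA ℤ.+ k₁ →
    + (rOut ℕ.+ cOut) ℤ.+ K ℤ.≤ + (rIn ℕ.+ cIn) → k₁ ℤ.+ k₂ ℤ.- + 1 ℤ.≤ K →
    + cOut ℤ.+ k₂ ℤ.≤ + cIn
  column-inequality rIn inA outA rOut cOut cIn K k₁ k₂ ≤inA outA≤ violated strong K≥ =
    by-slack _ (gap strong ⊕ gap violated ⊕ gapℕ ≤inA ⊕ gapℕ outA≤ ⊕ gap K≥)
      (solve 9 (λ rIn cIn rOut cOut K outA k₁ inA k₂ →
          ((rIn :+ cIn) :- ((rOut :+ cOut) :+ K)) :+ (((outA :+ k₁) :- (con (+ 1) :+ inA))
            :+ ((inA :- rIn) :+ ((rOut :- outA) :+ (K :- (k₁ :+ k₂ :- con (+ 1))))))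
          := cIn :- (cOut :+ k₂))
        refl (+ rIn) (+ cIn) (+ rOut) (+ cOut) K (+ outA) k₁ (+ inA) k₂)

  -- A vertex with no neighbours in S cannot satisfy the k-inequality, since all of its at
  -- least δ₁ + δ₂ neighbours lie outside S and k ≥ k₁ + k₂ - 1 ≥ 1 - δ₁ - δ₂.
  isolated-inequality : ∀ (rOut cOut δ₁ δ₂ : ℕ) (k k₁ k₂ : ℤ) →
    + (rOut ℕ.+ cOut) ℤ.+ k ℤ.≤ + 0 → δ₁ ℕ.≤ rOut → δ₂ ℕ.≤ cOut →
    + 1 ℤ.- + δ₁ ℤ.≤ k₁ → + 1 ℤ.- + δ₂ ℤ.≤ k₂ → k₁ ℤ.+ k₂ ℤ.- + 1 ℤ.≤ k → ⊥
  isolated-inequality rOut cOut δ₁ δ₂ k k₁ k₂ strong δ₁≤ δ₂≤ k₁≥ k₂≥ k≥ =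
    contradiction (subst (0ℤ ℤ.≤_) slack≡-1 (gap strong ⊕ gapℕ δ₁≤ ⊕ gapℕ δ₂≤ ⊕ gap k₁≥ ⊕ gap k₂≥ ⊕ gap k≥)) λ ()
    where
    slack≡-1 : (+ 0 ℤ.- (+ (rOut ℕ.+ cOut) ℤ.+ k)) ℤ.+ ((+ rOut ℤ.- + δ₁) ℤ.+ ((+ cOut ℤ.- + δ₂)
                 ℤ.+ ((k₁ ℤ.- (+ 1 ℤ.- + δ₁)) ℤ.+ ((k₂ ℤ.- (+ 1 ℤ.- + δ₂)) ℤ.+ (k ℤ.- (k₁ ℤ.+ k₂ ℤ.- + 1))))))
               ≡ ℤ.- + 1
    slack≡-1 = solve 7 (λ rOut cOut k δ₁ δ₂ k₁ k₂ →
        (con (+ 0) :- ((rOut :+ cOut) :+ k)) :+ ((rOut :- δ₁) :+ ((cOut :- δ₂)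
          :+ ((k₁ :- (con (+ 1) :- δ₁)) :+ ((k₂ :- (con (+ 1) :- δ₂)) :+ (k :- (k₁ :+ k₂ :- con (+ 1)))))))
        := :- con (+ 1))
      refl (+ rOut) (+ cOut) k (+ δ₁) (+ δ₂) k₁ k₂

  minus-plus : ∀ (k : ℤ) (Δ : ℕ) → (k ℤ.- + Δ) ℤ.+ + Δ ℤ.≤ k
  minus-plus k Δ = ℤP.≤-reflexive (solve 2 (λ k Δ → (k :- Δ) :+ Δ := k) refl k (+ Δ))

  -- Passing from the defensive to the offensive condition adds 2 to every threshold.
  plus-two : ∀ (T Δ K : ℤ) → T ℤ.+ Δ ℤ.≤ K → (T ℤ.+ + 2) ℤ.+ Δ ℤ.≤ K ℤ.+ + 2
  plus-two T Δ K T+Δ≤K = by-slack _ (gap T+Δ≤K)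
    (solve 3 (λ T Δ K → K :- (T :+ Δ) := (K :+ con (+ 2)) :- ((T :+ con (+ 2)) :+ Δ)) refl T Δ K)

  plus-two′ : ∀ (k₁ k₂ K : ℤ) → k₁ ℤ.+ k₂ ℤ.- + 1 ℤ.≤ K → k₁ ℤ.+ (k₂ ℤ.+ + 2) ℤ.- + 1 ℤ.≤ K ℤ.+ + 2
  plus-two′ k₁ k₂ K K≥ = by-slack _ (gap K≥)
    (solve 3 (λ k₁ k₂ K → K :- (k₁ :+ k₂ :- con (+ 1)) := (K :+ con (+ 2)) :- (k₁ :+ (k₂ :+ con (+ 2)) :- con (+ 1)))
      refl k₁ k₂ K)

-- Order-preserving matchings
--
-- For f : Fin m → Bool and g : Fin n → Bool, pairing the j-th true position of f with the
-- j-th true position of g matches min(count f, count g) pairs, and no position is used twice.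

rank : ∀ {n} → (Fin n → Bool) → Fin n → ℕ
rank f zero    = 0
rank f (suc i) = χ (f zero) ℕ.+ rank (λ j → f (suc j)) i

rank-injective : ∀ {n} (f : Fin n → Bool) a b → f a ≡ true → f b ≡ true → rank f a ≡ rank f b → a ≡ b
rank-injective f zero    zero    _  _  _  = refl
rank-injective f zero    (suc b) f₀ _  eq with trans eq (cong (λ t → χ t ℕ.+ rank (λ j → f (suc j)) b) f₀)
... | ()
rank-injective f (suc a) zero    _  f₀ eq with trans (≡.sym eq) (cong (λ t → χ t ℕ.+ rank (λ j → f (suc j)) a) f₀)
... | ()
rank-injective f (suc a) (suc b) fa fb eq =
  cong suc (rank-injective (λ j → f (suc j)) a b fa fb (ℕP.+-cancelˡ-≡ (χ (f zero)) _ _ eq))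

-- Exactly one true position of f has rank j if j < count f, and none otherwise.
-- The step lemma generalises over the value t of the first position so the induction goes through.
mutual
  count-rank≡ : ∀ n (f : Fin n → Bool) j → count n (λ b → f b ∧ (j ℕ.≡ᵇ rank f b)) ≡ χ (j ℕ.<ᵇ count n f)
  count-rank≡ ℕ.zero    f j = refl
  count-rank≡ (ℕ.suc n) f j = count-rank≡-step n (λ i → f (suc i)) (f zero) j

  count-rank≡-step : ∀ n (g : Fin n → Bool) t j →
    χ (t ∧ (j ℕ.≡ᵇ 0)) ℕ.+ count n (λ c → g c ∧ (j ℕ.≡ᵇ (χ t ℕ.+ rank g c)))
      ≡ χ (j ℕ.<ᵇ (χ t ℕ.+ count n g))
  count-rank≡-step n g true  ℕ.zero    = cong ℕ.suc (count-false n _ (λ c → ∧-zeroʳ (g c)))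
  count-rank≡-step n g true  (ℕ.suc j) = count-rank≡ n g j
  count-rank≡-step n g false j         = count-rank≡ n g j

mutual
  count-rank< : ∀ n (f : Fin n → Bool) M → count n (λ a → f a ∧ (rank f a ℕ.<ᵇ M)) ≡ count n f ⊓ M
  count-rank< ℕ.zero    f M = refl
  count-rank< (ℕ.suc n) f M = count-rank<-step n (λ i → f (suc i)) (f zero) M

  count-rank<-step : ∀ n (g : Fin n → Bool) t M →
    χ (t ∧ (0 ℕ.<ᵇ M)) ℕ.+ count n (λ c → g c ∧ ((χ t ℕ.+ rank g c) ℕ.<ᵇ M))
      ≡ (χ t ℕ.+ count n g) ⊓ M
  count-rank<-step n g true  ℕ.zero    = count-false n _ (λ c → ∧-zeroʳ (g c))
  count-rank<-step n g true  (ℕ.suc M) = cong ℕ.suc (count-rank< n g M)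
  count-rank<-step n g false M         = count-rank< n g M

matched : ∀ {m n} → (Fin m → Bool) → (Fin n → Bool) → Fin m → Fin n → Bool
matched f g a b = f a ∧ (g b ∧ (rank f a ℕ.≡ᵇ rank g b))

matched-size : ∀ m n (f : Fin m → Bool) (g : Fin n → Bool) →
  sum (λ a → count n (matched f g a)) ≡ count m f ⊓ count n g
matched-size m n f g = trans (sum-cong-≗ λ a → matches-of a (f a)) (count-rank< m f (count n g))
  where
  matches-of : ∀ a s → count n (λ b → s ∧ (g b ∧ (rank f a ℕ.≡ᵇ rank g b))) ≡ χ (s ∧ (rank f a ℕ.<ᵇ count n g))
  matches-of a true  = count-rank≡ n g (rank f a)
  matches-of a false = sum-replicate-zero n

matched⁻ : ∀ {m n} {f : Fin m → Bool} {g : Fin n → Bool} {a b} → matched f g a b ≡ true →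
  f a ≡ true × g b ≡ true × rank f a ≡ rank g b
matched⁻ {f = f} {g} {a} {b} e =
  let (fa , rest) = ∧-true e
      (gb , ranks) = ∧-true {g b} rest
  in fa , gb , ℕP.≡ᵇ⇒≡ (rank f a) (rank g b) (Equivalence.from T-≡ ranks)

matched-unique₁ : ∀ {m n} {f : Fin m → Bool} {g : Fin n → Bool} {a a′ b} →
  matched f g a b ≡ true → matched f g a′ b ≡ true → a ≡ a′
matched-unique₁ {f = f} {g} {a} {a′} {b} e e′ =
  let (fa , _ , ra) = matched⁻ {f = f} {g} {a} {b} e
      (fa′ , _ , ra′) = matched⁻ {f = f} {g} {a′} {b} e′
  in rank-injective f a a′ fa fa′ (trans ra (≡.sym ra′))

matched-unique₂ : ∀ {m n} {f : Fin m → Bool} {g : Fin n → Bool} {a b b′} →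
  matched f g a b ≡ true → matched f g a b′ ≡ true → b ≡ b′
matched-unique₂ {f = f} {g} {a} {b} {b′} e e′ =
  let (_ , gb , rb) = matched⁻ {f = f} {g} {a} {b} e
      (_ , gb′ , rb′) = matched⁻ {f = f} {g} {a} {b′} e′
  in rank-injective g b b′ gb gb′ (trans (≡.sym rb) rb′)

-- The Cartesian product G₁ □ G₂ and part (i)

-- Indicator form of the product adjacency of (a,b) and (c,d): p = [a = c] selects the
-- column edge y = b ~ d, q = [b = d] the row edge x = a ~ c; both cannot occur at once.
χ-edge : ∀ p q s x y → (p ≡ true → x ≡ false) →
  χ (s ∧ ((p ∧ y) ∨ (q ∧ x))) ≡ χ (q ∧ (s ∧ x)) ℕ.+ χ (p ∧ (s ∧ y))
χ-edge true  q     s     true  y     p⇒¬x with p⇒¬x refl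
... | ()
χ-edge true  false false false y     _ = refl
χ-edge true  true  false false y     _ = refl
χ-edge true  false true  false false _ = refl
χ-edge true  false true  false true  _ = refl
χ-edge true  true  true  false false _ = refl
χ-edge true  true  true  false true  _ = refl
χ-edge false false false x     y     _ = refl
χ-edge false false true  x     y     _ = refl
χ-edge false true  false x     y     _ = refl
χ-edge false true  true  x     y     _ = ≡.sym (ℕP.+-identityʳ (χ x))

module Product (G₁ G₂ : Graph) where

  P : Graph
  P = G₁ □ G₂

  n₁ n₂ : ℕ
  n₁ = n G₁
  n₂ = n G₂

  ⟨_,_⟩ : Fin n₁ → Fin n₂ → Fin (n₁ ℕ.* n₂)
  ⟨ a , b ⟩ = combine a b

  ⟨⟩-surjective : ∀ x → ∃₂ λ a b → ⟨ a , b ⟩ ≡ x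
  ⟨⟩-surjective x = proj₁ (remQuot {n₁} n₂ x) , proj₂ (remQuot {n₁} n₂ x) , combine-remQuot {n₁} n₂ x

  ∈-⟨⟩ : ∀ {S x} → x ∈ S → ∃₂ λ a b → ⟨ a , b ⟩ ∈ S
  ∈-⟨⟩ {S} {x} x∈ with ⟨⟩-surjective x
  ... | a , b , ⟨a,b⟩≡x = a , b , subst (_∈ S) (≡.sym ⟨a,b⟩≡x) x∈

  adj-⟨⟩ : ∀ a b c d → adj P ⟨ a , b ⟩ ⟨ c , d ⟩ ≡ (⌊ a ≟ c ⌋ ∧ adj G₂ b d) ∨ (⌊ b ≟ d ⌋ ∧ adj G₁ a c)
  adj-⟨⟩ a b c d = cong₂ edge (remQuot-combine a b) (remQuot-combine c d)
    where
    edge : Fin n₁ × Fin n₂ → Fin n₁ × Fin n₂ → Bool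
    edge (a , b) (c , d) = (⌊ a ≟ c ⌋ ∧ adj G₂ b d) ∨ (⌊ b ≟ d ⌋ ∧ adj G₁ a c)

  row-edge : ∀ {u c} b → adj G₁ u c ≡ true → adj P ⟨ u , b ⟩ ⟨ c , b ⟩ ≡ true
  row-edge {u} {c} b e = trans (adj-⟨⟩ u b c b)
    (trans (cong₂ (λ s t → (⌊ u ≟ c ⌋ ∧ adj G₂ b b) ∨ (s ∧ t)) (≟-refl b) e) (∨-zeroʳ _))

  col-edge : ∀ a {u d} → adj G₂ u d ≡ true → adj P ⟨ a , u ⟩ ⟨ a , d ⟩ ≡ true
  col-edge a {u} {d} e = trans (adj-⟨⟩ a u a d) (cong₂ (λ s t → (s ∧ t) ∨ (⌊ u ≟ d ⌋ ∧ adj G₁ a a)) (≟-refl a) e)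

  ⟦_⟧ : (Fin n₁ → Fin n₂ → Bool) → Subset (n₁ ℕ.* n₂)
  ⟦ g ⟧ = tabulate (λ x → g (proj₁ (remQuot {n₁} n₂ x)) (proj₂ (remQuot {n₁} n₂ x)))

  lookup-⟦⟧ : ∀ g a b → lookup ⟦ g ⟧ ⟨ a , b ⟩ ≡ g a b
  lookup-⟦⟧ g a b = trans (lookup∘tabulate _ ⟨ a , b ⟩) (cong (λ z → g (proj₁ z) (proj₂ z)) (remQuot-combine a b))

  ∈-⟦⟧ : ∀ {g a b} → ⟨ a , b ⟩ ∈ ⟦ g ⟧ → g a b ≡ true
  ∈-⟦⟧ {g} {a} {b} x∈ = trans (≡.sym (lookup-⟦⟧ g a b)) (∈⇒true x∈)

  ∣⟦⟧∣ : ∀ g → ∣ ⟦ g ⟧ ∣ ≡ sum (λ a → count n₂ (g a))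
  ∣⟦⟧∣ g = trans (∣∣≡count ⟦ g ⟧) (trans (sum-combine n₁ n₂ _)
    (sum-cong-≗ λ a → sum-cong-≗ λ b → cong χ (lookup-⟦⟧ g a b)))

  row : Subset (n₁ ℕ.* n₂) → Fin n₂ → Subset n₁
  row S b = tabulate (λ c → lookup S ⟨ c , b ⟩)

  col : Subset (n₁ ℕ.* n₂) → Fin n₁ → Subset n₂
  col S a = tabulate (λ d → lookup S ⟨ a , d ⟩)

  lookup-row : ∀ S b c → lookup (row S b) c ≡ lookup S ⟨ c , b ⟩
  lookup-row S b = lookup∘tabulate (λ c → lookup S ⟨ c , b ⟩)

  lookup-col : ∀ S a d → lookup (col S a) d ≡ lookup S ⟨ a , d ⟩
  lookup-col S a = lookup∘tabulate (λ d → lookup S ⟨ a , d ⟩)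

  ∈-row⁻ : ∀ {S c b} → c ∈ row S b → ⟨ c , b ⟩ ∈ S
  ∈-row⁻ {S} {c} {b} c∈ = true⇒∈ (trans (≡.sym (lookup-row S b c)) (∈⇒true c∈))

  ∈-row⁺ : ∀ {S c b} → ⟨ c , b ⟩ ∈ S → c ∈ row S b
  ∈-row⁺ {S} {c} {b} x∈ = true⇒∈ (trans (lookup-row S b c) (∈⇒true x∈))

  ∈-col⁻ : ∀ {S a d} → d ∈ col S a → ⟨ a , d ⟩ ∈ S
  ∈-col⁻ {S} {a} {d} d∈ = true⇒∈ (trans (≡.sym (lookup-col S a d)) (∈⇒true d∈))

  ∈-col⁺ : ∀ {S a d} → ⟨ a , d ⟩ ∈ S → d ∈ col S a
  ∈-col⁺ {S} {a} {d} x∈ = true⇒∈ (trans (lookup-col S a d) (∈⇒true x∈))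

  row-∁ : ∀ S b → row (∁ S) b ≡ ∁ (row S b)
  row-∁ S b = trans (tabulate-cong (λ c → lookup-map ⟨ c , b ⟩ not S)) (tabulate-∘ not _)

  col-∁ : ∀ S a → col (∁ S) a ≡ ∁ (col S a)
  col-∁ S a = trans (tabulate-cong (λ d → lookup-map ⟨ a , d ⟩ not S)) (tabulate-∘ not _)

  count-neighbours : ∀ (g : Fin (n₁ ℕ.* n₂) → Bool) a b →
    count (n₁ ℕ.* n₂) (λ y → g y ∧ adj P ⟨ a , b ⟩ y)
      ≡ count n₁ (λ c → g ⟨ c , b ⟩ ∧ adj G₁ a c) ℕ.+ count n₂ (λ d → g ⟨ a , d ⟩ ∧ adj G₂ b d)
  count-neighbours g a b = begin
    count (n₁ ℕ.* n₂) (λ y → g y ∧ adj P ⟨ a , b ⟩ y)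
      ≡⟨ sum-combine n₁ n₂ _ ⟩
    sum (λ c → sum (λ d → χ (g ⟨ c , d ⟩ ∧ adj P ⟨ a , b ⟩ ⟨ c , d ⟩)))
      ≡⟨ sum-cong-≗ (λ c → sum-cong-≗ (λ d → split c d)) ⟩
    sum (λ c → sum (λ d → H c d ℕ.+ V c d))
      ≡⟨ sum-cong-≗ (λ c → ∑-distrib-+ (H c) (V c)) ⟩
    sum (λ c → sum (H c) ℕ.+ sum (V c))
      ≡⟨ ∑-distrib-+ (λ c → sum (H c)) (λ c → sum (V c)) ⟩
    sum (λ c → sum (H c)) ℕ.+ sum (λ c → sum (V c))
      ≡⟨ cong (sum (λ c → sum (H c)) ℕ.+_) (∑-comm V) ⟩
    sum (λ c → sum (H c)) ℕ.+ sum (λ d → sum (λ c → V c d))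
      ≡⟨ cong₂ ℕ._+_ (sum-cong-≗ λ c → sum-indicator b (λ d → g ⟨ c , d ⟩ ∧ adj G₁ a c))
                     (sum-cong-≗ λ d → sum-indicator a (λ c → g ⟨ c , d ⟩ ∧ adj G₂ b d)) ⟩
    count n₁ (λ c → g ⟨ c , b ⟩ ∧ adj G₁ a c) ℕ.+ count n₂ (λ d → g ⟨ a , d ⟩ ∧ adj G₂ b d) ∎
    where
    open ≡-Reasoning
    H V : Fin n₁ → Fin n₂ → ℕ
    H c d = χ (⌊ b ≟ d ⌋ ∧ (g ⟨ c , d ⟩ ∧ adj G₁ a c))
    V c d = χ (⌊ a ≟ c ⌋ ∧ (g ⟨ c , d ⟩ ∧ adj G₂ b d))
    split : ∀ c d → χ (g ⟨ c , d ⟩ ∧ adj P ⟨ a , b ⟩ ⟨ c , d ⟩) ≡ H c d ℕ.+ V c d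
    split c d = trans (cong (λ t → χ (g ⟨ c , d ⟩ ∧ t)) (adj-⟨⟩ a b c d))
      (χ-edge ⌊ a ≟ c ⌋ ⌊ b ≟ d ⌋ (g ⟨ c , d ⟩) (adj G₁ a c) (adj G₂ b d)
        (λ a≡c → subst (λ z → adj G₁ a z ≡ false) (≟⇒≡ a c a≡c) (irrefl G₁ a)))

  δ-product : ∀ S a b → δ[ P , S ] ⟨ a , b ⟩ ≡ δ[ G₁ , row S b ] a ℕ.+ δ[ G₂ , col S a ] b
  δ-product S a b = trans (δ-count P S ⟨ a , b ⟩) (trans (count-neighbours (lookup S) a b)
    (≡.sym (cong₂ ℕ._+_
      (trans (δ-count G₁ (row S b) a) (sum-cong-≗ λ c → cong (λ t → χ (t ∧ adj G₁ a c)) (lookup-row S b c)))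
      (trans (δ-count G₂ (col S a) b) (sum-cong-≗ λ d → cong (λ t → χ (t ∧ adj G₂ b d)) (lookup-col S a d))))))

  δ∁-product : ∀ S a b → δ[ P , ∁ S ] ⟨ a , b ⟩ ≡ δ[ G₁ , ∁ (row S b) ] a ℕ.+ δ[ G₂ , ∁ (col S a) ] b
  δ∁-product S a b = trans (δ-product (∁ S) a b)
    (cong₂ (λ R C → δ[ G₁ , R ] a ℕ.+ δ[ G₂ , C ] b) (row-∁ S b) (col-∁ S a))

  strong-product : ∀ S K a b → Strong P S K ⟨ a , b ⟩ →
    + (δ[ G₁ , ∁ (row S b) ] a ℕ.+ δ[ G₂ , ∁ (col S a) ] b) ℤ.+ K ℤ.≤ + (δ[ G₁ , row S b ] a ℕ.+ δ[ G₂ , col S a ] b)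
  strong-product S K a b = subst₂ (λ o i → + o ℤ.+ K ℤ.≤ + i) (δ∁-product S a b) (δ-product S a b)

  -- Column neighbours contribute at most Δ₂, so the K-inequality at (c,b) gives the
  -- T-inequality of the row through b at c whenever T + Δ₂ ≤ K; symmetrically for columns.
  row-strong : ∀ S K T c b → Strong P S K ⟨ c , b ⟩ → T ℤ.+ + maxDeg G₂ ℤ.≤ K → Strong G₁ (row S b) T c
  row-strong S K T c b strong T+Δ≤K =
    drop-bounded-part _ _ _ _ (maxDeg G₂) K T (strong-product S K c b strong)
      (ℕP.≤-trans (δ≤deg G₂ (col S c) b) (deg≤maxDeg G₂ b)) T+Δ≤K

  col-strong : ∀ S K T a d → Strong P S K ⟨ a , d ⟩ → T ℤ.+ + maxDeg G₁ ℤ.≤ K → Strong G₂ (col S a) T d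
  col-strong S K T a d strong T+Δ≤K =
    drop-bounded-part _ _ _ _ (maxDeg G₁) K T
      (subst₂ (λ o i → + o ℤ.+ K ℤ.≤ + i)
        (ℕP.+-comm (δ[ G₁ , ∁ (row S d) ] a) (δ[ G₂ , ∁ (col S a) ] d))
        (ℕP.+-comm (δ[ G₁ , row S d ] a) (δ[ G₂ , col S a ] d))
        (strong-product S K a d strong))
      (ℕP.≤-trans (δ≤deg G₁ (row S d) a) (deg≤maxDeg G₁ a)) T+Δ≤K

  row-powerful : ∀ {S K T c b} → PowerfulAlliance P K S → ⟨ c , b ⟩ ∈ S → T ℤ.+ + maxDeg G₂ ℤ.≤ K →
    PowerfulAlliance G₁ T (row S b)
  row-powerful {S} {K} {T} {c} {b} ((_ , defensive) , (_ , offensive)) x∈ T+Δ≤K =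
    (nonempty , λ c′ c′∈ → row-strong S K T c′ b (defensive _ (∈-row⁻ c′∈)) T+Δ≤K) ,
    (nonempty , λ c′ c′∉ (u , u∈ , u~c′) →
      row-strong S (K ℤ.+ + 2) (T ℤ.+ + 2) c′ b
        (offensive _ (λ x∈ → c′∉ (∈-row⁺ x∈)) (⟨ u , b ⟩ , ∈-row⁻ u∈ , row-edge b u~c′))
        (plus-two T (+ maxDeg G₂) K T+Δ≤K))
    where
    nonempty : Nonempty (row S b)
    nonempty = c , ∈-row⁺ x∈

  col-powerful : ∀ {S K T a d} → PowerfulAlliance P K S → ⟨ a , d ⟩ ∈ S → T ℤ.+ + maxDeg G₁ ℤ.≤ K →
    PowerfulAlliance G₂ T (col S a)
  col-powerful {S} {K} {T} {a} {d} ((_ , defensive) , (_ , offensive)) x∈ T+Δ≤K =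
    (nonempty , λ d′ d′∈ → col-strong S K T a d′ (defensive _ (∈-col⁻ d′∈)) T+Δ≤K) ,
    (nonempty , λ d′ d′∉ (u , u∈ , u~d′) →
      col-strong S (K ℤ.+ + 2) (T ℤ.+ + 2) a d′
        (offensive _ (λ x∈ → d′∉ (∈-col⁺ x∈)) (⟨ a , u ⟩ , ∈-col⁻ u∈ , col-edge a u~d′))
        (plus-two T (+ maxDeg G₁) K T+Δ≤K))
    where
    nonempty : Nonempty (col S a)
    nonempty = d , ∈-col⁺ x∈

  row-cylinder : Subset n₁ → Subset (n₁ ℕ.* n₂)
  row-cylinder X = ⟦ (λ a _ → lookup X a) ⟧

  col-cylinder : Subset n₂ → Subset (n₁ ℕ.* n₂)
  col-cylinder X = ⟦ (λ _ b → lookup X b) ⟧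

  -- A powerful K-alliance inside a cylinder would have a row (column) that is a powerful
  -- T-alliance inside X.
  row-cylinder-paf : ∀ {K T X} → T ℤ.+ + maxDeg G₂ ℤ.≤ K → PAF G₁ T X → PAF P K (row-cylinder X)
  row-cylinder-paf {T = T} T+Δ≤K pafX S S⊆Y powerful with ∈-⟨⟩ (proj₂ (proj₁ (proj₁ powerful)))
  ... | a , b , x∈ =
    pafX (row S b) (λ c∈ → true⇒∈ (∈-⟦⟧ (S⊆Y (∈-row⁻ c∈)))) (row-powerful {T = T} powerful x∈ T+Δ≤K)

  col-cylinder-paf : ∀ {K T X} → T ℤ.+ + maxDeg G₁ ℤ.≤ K → PAF G₂ T X → PAF P K (col-cylinder X)
  col-cylinder-paf {T = T} T+Δ≤K pafX S S⊆Y powerful with ∈-⟨⟩ (proj₂ (proj₁ (proj₁ powerful)))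
  ... | a , b , x∈ =
    pafX (col S a) (λ d∈ → true⇒∈ (∈-⟦⟧ (S⊆Y (∈-col⁻ d∈)))) (col-powerful {T = T} powerful x∈ T+Δ≤K)

  ∣row-cylinder∣ : ∀ X → ∣ row-cylinder X ∣ ≡ n₂ ℕ.* ∣ X ∣
  ∣row-cylinder∣ X = begin
    ∣ row-cylinder X ∣                          ≡⟨ ∣⟦⟧∣ _ ⟩
    sum (λ a → sum {n₂} (λ _ → χ (lookup X a))) ≡⟨ sum-cong-≗ (λ a → sum-const n₂ (χ (lookup X a))) ⟩
    sum (λ a → n₂ ℕ.* χ (lookup X a))           ≡⟨ ≡.sym (*-distribˡ-sum n₂ (λ a → χ (lookup X a))) ⟩
    n₂ ℕ.* count n₁ (lookup X)                  ≡⟨ cong (n₂ ℕ.*_) (≡.sym (∣∣≡count X)) ⟩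
    n₂ ℕ.* ∣ X ∣ ∎
    where open ≡-Reasoning

  ∣col-cylinder∣ : ∀ X → ∣ col-cylinder X ∣ ≡ n₁ ℕ.* ∣ X ∣
  ∣col-cylinder∣ X = begin
    ∣ col-cylinder X ∣                   ≡⟨ ∣⟦⟧∣ _ ⟩
    sum {n₁} (λ _ → count n₂ (lookup X)) ≡⟨ sum-const n₁ (count n₂ (lookup X)) ⟩
    n₁ ℕ.* count n₂ (lookup X)           ≡⟨ cong (n₁ ℕ.*_) (≡.sym (∣∣≡count X)) ⟩
    n₁ ℕ.* ∣ X ∣ ∎
    where open ≡-Reasoning

  part-i₁ : ∀ {k p q} → IsPhi P k p → IsPhi G₁ (k ℤ.- + maxDeg G₂) q → n₂ ℕ.* q ℕ.≤ p
  part-i₁ {k} {p} (_ , maximal) ((X , pafX , refl) , _) =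
    subst (ℕ._≤ p) (∣row-cylinder∣ X)
      (maximal _ (row-cylinder-paf {T = k ℤ.- + maxDeg G₂} (minus-plus k (maxDeg G₂)) pafX))

  part-i₂ : ∀ {k p q} → IsPhi P k p → IsPhi G₂ (k ℤ.- + maxDeg G₁) q → n₁ ℕ.* q ℕ.≤ p
  part-i₂ {k} {p} (_ , maximal) ((X , pafX , refl) , _) =
    subst (ℕ._≤ p) (∣col-cylinder∣ X)
      (maximal _ (col-cylinder-paf {T = k ℤ.- + maxDeg G₁} (minus-plus k (maxDeg G₁)) pafX))

-- Part (ii)

module PartII (G₁ G₂ : Graph) (k₁ k₂ k : ℤ)
  (k₁≥ : + 1 ℤ.- + minDeg G₁ ℤ.≤ k₁) (k₂≥ : + 1 ℤ.- + minDeg G₂ ℤ.≤ k₂) (k≥ : k₁ ℤ.+ k₂ ℤ.- + 1 ℤ.≤ k)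
  (X₁ : Subset (n G₁)) (X₂ : Subset (n G₂)) (paf₁ : PAF G₁ k₁ X₁) (paf₂ : PAF G₂ k₂ X₂) where

  open Product G₁ G₂

  x₁ : Fin n₁ → Bool
  x₁ = lookup X₁

  x₂ : Fin n₂ → Bool
  x₂ = lookup X₂

  out₁ : Fin n₁ → Bool
  out₁ a = not (x₁ a)

  out₂ : Fin n₂ → Bool
  out₂ b = not (x₂ b)

  D : Fin n₁ → Fin n₂ → Bool
  D = matched out₁ out₂

  D⁻ : ∀ {a b} → D a b ≡ true → out₁ a ≡ true × out₂ b ≡ true
  D⁻ {a} {b} aDb = let (a∉ , b∉ , _) = matched⁻ {f = out₁} {out₂} {a} {b} aDb in a∉ , b∉

  D-unique₁ : ∀ {a a′ b} → D a b ≡ true → D a′ b ≡ true → a ≡ a′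
  D-unique₁ {a} {a′} {b} = matched-unique₁ {f = out₁} {out₂} {a} {a′} {b}

  D-unique₂ : ∀ {a b b′} → D a b ≡ true → D a b′ ≡ true → b ≡ b′
  D-unique₂ {a} {b} {b′} = matched-unique₂ {f = out₁} {out₂} {a} {b} {b′}

  Y : Subset (n₁ ℕ.* n₂)
  Y = ⟦ (λ a b → (x₁ a ∧ x₂ b) ∨ D a b) ⟧

  ∣Y∣ : ∣ Y ∣ ≡ ∣ X₁ ∣ ℕ.* ∣ X₂ ∣ ℕ.+ (n₁ ∸ ∣ X₁ ∣) ⊓ (n₂ ∸ ∣ X₂ ∣)
  ∣Y∣ = begin
    ∣ Y ∣
      ≡⟨ ∣⟦⟧∣ _ ⟩
    sum (λ a → count n₂ (λ b → (x₁ a ∧ x₂ b) ∨ D a b))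
      ≡⟨ sum-cong-≗ (λ a → trans (sum-cong-≗ (λ b → χ-disjoint (x₁ a) (x₂ b) _))
                                  (∑-distrib-+ (λ b → χ (x₁ a ∧ x₂ b)) (λ b → χ (D a b)))) ⟩
    sum (λ a → count n₂ (λ b → x₁ a ∧ x₂ b) ℕ.+ count n₂ (D a))
      ≡⟨ ∑-distrib-+ (λ a → count n₂ (λ b → x₁ a ∧ x₂ b)) (λ a → count n₂ (D a)) ⟩
    sum (λ a → count n₂ (λ b → x₁ a ∧ x₂ b)) ℕ.+ sum (λ a → count n₂ (D a))
      ≡⟨ cong₂ ℕ._+_ (sum-product n₁ n₂ x₁ x₂) (matched-size n₁ n₂ out₁ out₂) ⟩
    count n₁ x₁ ℕ.* count n₂ x₂ ℕ.+ count n₁ out₁ ⊓ count n₂ out₂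
      ≡⟨ cong₂ ℕ._+_ (cong₂ ℕ._*_ (≡.sym (∣∣≡count X₁)) (≡.sym (∣∣≡count X₂)))
                     (cong₂ _⊓_ (count-∁ X₁) (count-∁ X₂)) ⟩
    ∣ X₁ ∣ ℕ.* ∣ X₂ ∣ ℕ.+ (n₁ ∸ ∣ X₁ ∣) ⊓ (n₂ ∸ ∣ X₂ ∣) ∎
    where
    open ≡-Reasoning
    -- D only meets pairs outside X₁ × X₂, so the union is disjoint.
    χ-disjoint : ∀ x y z → χ ((x ∧ y) ∨ (not x ∧ z)) ≡ χ (x ∧ y) ℕ.+ χ (not x ∧ z)
    χ-disjoint true  true  z     = refl
    χ-disjoint true  false z     = refl
    χ-disjoint false y     true  = refl
    χ-disjoint false y     false = refl

  module _ {S : Subset (n₁ ℕ.* n₂)} (S⊆Y : S ⊆ Y) (powerful : PowerfulAlliance P k S) where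

    defensive : ∀ x → x ∈ S → Strong P S k x
    defensive = proj₂ (proj₁ powerful)

    offensive : ∀ x → x ∉ S → (∃ λ u → u ∈ S × adj P u x ≡ true) → Strong P S (k ℤ.+ + 2) x
    offensive = proj₂ (proj₂ powerful)

    ∈S⇒∈Y : ∀ {c d} → ⟨ c , d ⟩ ∈ S → (x₁ c ≡ true × x₂ d ≡ true) ⊎ D c d ≡ true
    ∈S⇒∈Y {c} x∈ with ∨-true (∈-⟦⟧ (S⊆Y x∈))
    ... | inj₁ both = inj₁ (∧-true {x₁ c} both)
    ... | inj₂ cDd  = inj₂ cDd

    -- A matched vertex (c,d) has no neighbour in S: any (u,d) ∈ S is matched as d ∉ X₂,
    -- hence u = c, and likewise in the column.  So it cannot belong to S.
    unmatched : ∀ {c d} → ⟨ c , d ⟩ ∈ S → D c d ≡ true → ⊥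
    unmatched {c} {d} x∈ cDd =
      isolated-inequality _ _ (minDeg G₁) (minDeg G₂) k k₁ k₂ isolated
        (minDeg≤δ∁ G₁ (row S d) c row-empty) (minDeg≤δ∁ G₂ (col S c) d col-empty) k₁≥ k₂≥ k≥
      where
      row-empty : δ[ G₁ , row S d ] c ≡ 0
      row-empty = no-neighbours G₁ (row S d) c λ u u∈ c~u → case ∈S⇒∈Y (∈-row⁻ u∈) of λ where
        (inj₁ (_ , d∈)) → not-true d∈ (proj₂ (D⁻ cDd))
        (inj₂ uDd)      → no-loop G₁ (D-unique₁ uDd cDd) c~u
      col-empty : δ[ G₂ , col S c ] d ≡ 0
      col-empty = no-neighbours G₂ (col S c) d λ u u∈ d~u → case ∈S⇒∈Y (∈-col⁻ u∈) of λ where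
        (inj₁ (c∈ , _)) → not-true c∈ (proj₁ (D⁻ cDd))
        (inj₂ cDu)      → no-loop G₂ (D-unique₂ cDu cDd) d~u
      isolated : + (δ[ G₁ , ∁ (row S d) ] c ℕ.+ δ[ G₂ , ∁ (col S c) ] d) ℤ.+ k ℤ.≤ + 0
      isolated = subst₂ (λ i j → + (δ[ G₁ , ∁ (row S d) ] c ℕ.+ δ[ G₂ , ∁ (col S c) ] d) ℤ.+ k ℤ.≤ + (i ℕ.+ j))
        row-empty col-empty (strong-product S k c d (defensive _ x∈))

    ∈S⇒∈X : ∀ {c d} → ⟨ c , d ⟩ ∈ S → c ∈ X₁ × d ∈ X₂
    ∈S⇒∈X x∈ with ∈S⇒∈Y x∈
    ... | inj₁ (c∈ , d∈) = true⇒∈ c∈ , true⇒∈ d∈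
    ... | inj₂ cDd       = ⊥-elim (unmatched x∈ cDd)

    A : Subset n₁
    A = tabulate (λ a → ⌊ any? (λ b → ⟨ a , b ⟩ ∈? S) ⌋)

    ∈A⁺ : ∀ {a b} → ⟨ a , b ⟩ ∈ S → a ∈ A
    ∈A⁺ {a} {b} x∈ = true⇒∈ (trans (lookup∘tabulate _ a) (Equivalence.to T-≡ (fromWitness (b , x∈))))

    ∈A⁻ : ∀ {a} → a ∈ A → ∃ λ b → ⟨ a , b ⟩ ∈ S
    ∈A⁻ {a} a∈ = toWitness (Equivalence.from T-≡ (trans (≡.sym (lookup∘tabulate _ a)) (∈⇒true a∈)))

    A⊆X₁ : A ⊆ X₁
    A⊆X₁ a∈ = proj₁ (∈S⇒∈X (proj₂ (∈A⁻ a∈)))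

    A-nonempty : Nonempty A
    A-nonempty with ∈-⟨⟩ (proj₂ (proj₁ (proj₁ powerful)))
    ... | a , b , x∈ = a , ∈A⁺ x∈

    row⊆A : ∀ b → row S b ⊆ A
    row⊆A b c∈ = ∈A⁺ (∈-row⁻ c∈)

    ∁A⊆∁row : ∀ b → ∁ A ⊆ ∁ (row S b)
    ∁A⊆∁row b c∈ = x∉p⇒x∈∁p (λ c∈row → x∈∁p⇒x∉p c∈ (row⊆A b c∈row))

    -- A is an offensive (k₁+2)-alliance: for a ∉ A next to (u,b) ∈ S, the vertex (a,b) ∉ S
    -- satisfies the (k+2)-inequality while its column contains no vertex of S.
    A-offensive : ∀ a → a ∉ A → (∃ λ u → u ∈ A × adj G₁ u a ≡ true) → Strong G₁ A (k₁ ℤ.+ + 2) a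
    A-offensive a a∉ (u , u∈ , u~a) with ∈A⁻ u∈
    ... | b , ub∈ =
      projection-inequality _ _ _ _ _ (minDeg G₂) k k₁ k₂ (δ-mono G₁ a (∁A⊆∁row b)) (δ-mono G₁ a (row⊆A b))
        strong k≥ k₂≥ (minDeg≤δ∁ G₂ (col S a) b col-empty)
      where
      col-empty : δ[ G₂ , col S a ] b ≡ 0
      col-empty = no-neighbours G₂ (col S a) b (λ d d∈ _ → a∉ (∈A⁺ (∈-col⁻ d∈)))
      rIn : ℕ
      rIn = δ[ G₁ , row S b ] a
      strong : + (δ[ G₁ , ∁ (row S b) ] a ℕ.+ δ[ G₂ , ∁ (col S a) ] b) ℤ.+ (k ℤ.+ + 2) ℤ.≤ + rIn
      strong = subst (λ i → + (δ[ G₁ , ∁ (row S b) ] a ℕ.+ δ[ G₂ , ∁ (col S a) ] b) ℤ.+ (k ℤ.+ + 2) ℤ.≤ + i)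
        (trans (cong (rIn ℕ.+_) col-empty) (ℕP.+-identityʳ rIn))
        (strong-product S (k ℤ.+ + 2) a b
          (offensive _ (λ ab∈ → a∉ (∈A⁺ ab∈)) (⟨ u , b ⟩ , ub∈ , row-edge b u~a)))

    col-powerful-at : ∀ {a} → a ∈ A → ¬ Strong G₁ A k₁ a → PowerfulAlliance G₂ k₂ (col S a)
    col-powerful-at {a} a∈ violated =
      (nonempty , λ d d∈ → col-bound k k₂ k≥ (defensive _ (∈-col⁻ d∈))) ,
      (nonempty , λ d d∉ (u , u∈ , u~d) →
        col-bound (k ℤ.+ + 2) (k₂ ℤ.+ + 2) (plus-two′ k₁ k₂ k k≥)
          (offensive _ (λ x∈ → d∉ (∈-col⁺ x∈)) (⟨ a , u ⟩ , ∈-col⁻ u∈ , col-edge a u~d)))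
      where
      nonempty : Nonempty (col S a)
      nonempty = let (b , ab∈) = ∈A⁻ a∈ in b , ∈-col⁺ ab∈
      violated′ : + 1 ℤ.+ + δ[ G₁ , A ] a ℤ.≤ + δ[ G₁ , ∁ A ] a ℤ.+ k₁
      violated′ = ℤP.i<j⇒suc[i]≤j (ℤP.≰⇒> violated)
      col-bound : ∀ {d} K T → k₁ ℤ.+ T ℤ.- + 1 ℤ.≤ K → Strong P S K ⟨ a , d ⟩ → Strong G₂ (col S a) T d
      col-bound {d} K T K≥ strong =
        column-inequality _ _ _ _ _ _ K k₁ T (δ-mono G₁ a (row⊆A d)) (δ-mono G₁ a (∁A⊆∁row d)) violated′
          (strong-product S K a d strong) K≥

    no-powerful-subset : ⊥
    no-powerful-subset with all-or-counterexample A (Strong G₁ A k₁) (λ a → _ ℤP.≤? _)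
    ... | inj₁ A-defensive     = paf₁ A A⊆X₁ ((A-nonempty , A-defensive) , (A-nonempty , A-offensive))
    ... | inj₂ (a , a∈ , viol) = paf₂ (col S a) (λ d∈ → proj₂ (∈S⇒∈X (∈-col⁻ d∈))) (col-powerful-at a∈ viol)

  Y-paf : PAF P k Y
  Y-paf S S⊆Y powerful = no-powerful-subset S⊆Y powerful

part-ii : ∀ (G₁ G₂ : Graph) (k₁ k₂ k : ℤ) →
  + 1 ℤ.- + minDeg G₁ ℤ.≤ k₁ → + 1 ℤ.- + minDeg G₂ ℤ.≤ k₂ → k₁ ℤ.+ k₂ ℤ.- + 1 ℤ.≤ k →
  ∀ {p φ₁ φ₂} → IsPhi (G₁ □ G₂) k p → IsPhi G₁ k₁ φ₁ → IsPhi G₂ k₂ φ₂ →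
  φ₁ ℕ.* φ₂ ℕ.+ ((n G₁ ∸ φ₁) ⊓ (n G₂ ∸ φ₂)) ℕ.≤ p
part-ii G₁ G₂ k₁ k₂ k k₁≥ k₂≥ k≥ {p} (_ , maximal) ((X₁ , paf₁ , refl) , _) ((X₂ , paf₂ , refl) , _) =
  subst (ℕ._≤ p) ∣Y∣ (maximal Y Y-paf)
  where open PartII G₁ G₂ k₁ k₂ k k₁≥ k₂≥ k≥ X₁ X₂ paf₁ paf₂

corollary15 :
    (G₁ G₂ : Graph) (k₁ k₂ : ℤ) →
    (+ 1) ℤ.- (+ minDeg G₁) ℤ.≤ k₁ → k₁ ℤ.≤ (+ maxDeg G₁) ℤ.- (+ 2) →
    (+ 1) ℤ.- (+ minDeg G₂) ℤ.≤ k₂ → k₂ ℤ.≤ (+ maxDeg G₂) ℤ.- (+ 2) →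
    -- (i) with i = 1, j = 2
    ((k : ℤ) →
      (+ maxDeg G₂) ℤ.- (+ maxDeg G₁) ℤ.≤ k →
      k ℤ.≤ (+ maxDeg G₁) ℤ.+ (+ maxDeg G₂) ℤ.- (+ 2) →
      (p q : ℕ) → IsPhi (G₁ □ G₂) k p → IsPhi G₁ (k ℤ.- (+ maxDeg G₂)) q →
      order G₂ ℕ.* q ℕ.≤ p)
    ×
    -- (i) with i = 2, j = 1
    ((k : ℤ) →
      (+ maxDeg G₁) ℤ.- (+ maxDeg G₂) ℤ.≤ k →
      k ℤ.≤ (+ maxDeg G₁) ℤ.+ (+ maxDeg G₂) ℤ.- (+ 2) →
      (p q : ℕ) → IsPhi (G₁ □ G₂) k p → IsPhi G₂ (k ℤ.- (+ maxDeg G₁)) q →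
      order G₁ ℕ.* q ℕ.≤ p)
    ×
    -- (ii)
    ((k : ℤ) →
      k₁ ℤ.+ k₂ ℤ.- (+ 1) ℤ.≤ k →
      k ℤ.≤ (+ maxDeg G₁) ℤ.+ (+ maxDeg G₂) ℤ.- (+ 2) →
      (p φ₁ φ₂ : ℕ) → IsPhi (G₁ □ G₂) k p → IsPhi G₁ k₁ φ₁ → IsPhi G₂ k₂ φ₂ →
      φ₁ ℕ.* φ₂ ℕ.+ ((order G₁ ∸ φ₁) ⊓ (order G₂ ∸ φ₂)) ℕ.≤ p)
corollary15 G₁ G₂ k₁ k₂ k₁≥ _ k₂≥ _ =
  (λ k _ _ _ _ → part-i₁ {k}) ,
  (λ k _ _ _ _ → part-i₂ {k}) ,
  (λ k k≥ _ _ _ _ → part-ii G₁ G₂ k₁ k₂ k k₁≥ k₂≥ k≥)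
  where open Product G₁ G₂ using (part-i₁; part-i₂)
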